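{- Let $G$ be a graph and let $f$ be a first kind semi-arithmetic IASI of $G$. Then $f$ is a strong IASI of $G$; that is, $|f^{+}(uv)| = |f(u)|\,|f(v)|$ for every edge $uv$ of $G$.
   Context: All graphs are simple, finite, without isolated vertices; $\mathbb{N}_0$ is the set of non-negative integers and all sets are finite subsets of $\mathbb{N}_0$. For $A,B\subseteq\mathbb{N}_0$, $A+B=\{a+b: a\in A, b\in B\}$. An integer additive set-indexer (IASI) of $G$ is an injective function $f:V(G)\to 2^{\mathbb{N}_0}$ such that the induced map $f^{+}:E(G)\to 2^{\mathbb{N}_0}$, $f^{+}(uv)=f(u)+f(v)$, is also injective. An AP-set is a set whose elements are in arithmetic progression; set-labels that are AP-sets are required to have at least three elements. The common difference of an AP-set label of an element is called its deterministic index. An IASI $f$ is vertex-arithmetic if $f(v)$ is an AP-set for every vertex $v$. A first kind semi-arithmetic IASI is a vertex-arithmetic IASI $f$ such that for adjacent vertices $v_i,v_j$ with deterministic indices $d_i,d_j$, one has $d_j=k d_i$ for a non-negative integer $k$ greater than $|f(v_i)|$. An IASI $f$ is strong if $|f^{+}(uv)|=|f(u)|\,|f(v)|$ for all adjacent $u,v$. -}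

module Defs where

open import Data.Nat using (ℕ; _+_; _*_; _≤_; _<_)
open import Data.Nat.Properties using (_≟_)
open import Data.Fin using (Fin)
open import Data.List using (List; map; concatMap; length; deduplicate; upTo)
open import Data.List.Membership.Propositional using (_∈_)
open import Data.Product using (Σ; _×_; ∃)
open import Data.Sum using (_⊎_)
open import Relation.Binary.PropositionalEquality using (_≡_)
open import Relation.Nullary using (¬_)
open import Function.Bundles using (_⇔_)

-- A finite subset of ℕ₀ is represented by a list enumerating it
-- (repetitions and order are irrelevant; the set is its membership predicate).
FinSet : Set
FinSet = List ℕ

_≈ₛ_ : FinSet → FinSet → Set
A ≈ₛ B = ∀ x → (x ∈ A) ⇔ (x ∈ B)

card : FinSet → ℕ
card A = length (deduplicate _≟_ A)

_⊕_ : FinSet → FinSet → FinSet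
A ⊕ B = concatMap (λ a → map (a +_) B) A

record Graph (n : ℕ) : Set₁ where
  field
    Adj      : Fin n → Fin n → Set
    irrefl   : ∀ u → ¬ Adj u u
    sym      : ∀ u v → Adj u v → Adj v u
    noIsol   : ∀ u → ∃ λ v → Adj u v

open Graph public

IsIASI : ∀ {n} → Graph n → (Fin n → FinSet) → Set
IsIASI {n} G f =
  (∀ u v → f u ≈ₛ f v → u ≡ v) ×
  (∀ u v x y → Adj G u v → Adj G x y → (f u ⊕ f v) ≈ₛ (f x ⊕ f y) →
     (u ≡ x × v ≡ y) ⊎ (u ≡ y × v ≡ x))

IsAPWith : FinSet → ℕ → Set
IsAPWith A d = Σ ℕ λ a → Σ ℕ λ k → 3 ≤ k × 1 ≤ d ×
  (A ≈ₛ map (λ i → a + i * d) (upTo k))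

IsVertexArithmetic : ∀ {n} → Graph n → (Fin n → FinSet) → Set
IsVertexArithmetic {n} G f = IsIASI G f × (∀ v → ∃ λ d → IsAPWith (f v) d)

MultipleCond : FinSet → ℕ → ℕ → Set
MultipleCond Ai di dj = ∃ λ k → card Ai < k × dj ≡ k * di

IsSemiArith1 : ∀ {n} → Graph n → (Fin n → FinSet) → Set
IsSemiArith1 {n} G f = IsVertexArithmetic G f ×
  (∀ u v → Adj G u v → ∀ du dv → IsAPWith (f u) du → IsAPWith (f v) dv →
     MultipleCond (f u) du dv ⊎ MultipleCond (f v) dv du)

IsStrong : ∀ {n} → Graph n → (Fin n → FinSet) → Set
IsStrong {n} G f = IsIASI G f ×
  (∀ u v → Adj G u v → card (f u ⊕ f v) ≡ card (f u) * card (f v))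

-- Write A = {a + i·d : i < k} and B = {b + j·K·d : j < m} with k ≤ K. Every sum is
-- a + b + (i + j·K)·d, and since i < K the pair (i, j) is recovered from i + j·K as
-- the remainder and quotient of division by K. So the k·m sums are pairwise distinct,
-- i.e. |A + B| = |A|·|B|. In a first kind semi-arithmetic IASI the ratio K of the
-- deterministic indices along an edge exceeds |A| = k, so this applies to every edge.
module Submission where

open import Defs hiding (sym)
open import Data.Nat using (ℕ; suc; _+_; _*_; _≤_; _<_; NonZero; >-nonZero)
open import Data.Nat.Properties
  using (_≟_; +-comm; +-cancelˡ-≡; *-cancelʳ-≡; *-comm; <-≤-trans; <⇒≤)
open import Data.Nat.DivMod using (_%_; m<n⇒m%n≡m; [m+kn]%n≡m%n)
open import Data.Nat.Solver using (module +-*-Solver)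
open import Data.Fin using (Fin; toℕ; fromℕ<)
open import Data.Fin.Properties using (toℕ<n; toℕ-fromℕ<; toℕ-injective)
open import Data.List using (List; []; _∷_; _++_; map; length; deduplicate; upTo; allFin; cartesianProductWith)
open import Data.List.Properties using (length-map; length-upTo; length-++; length-tabulate)
open import Data.List.Membership.Propositional using (_∈_; find; lose)
open import Data.List.Membership.Propositional.Properties
  using (∈-map⁺; ∈-map⁻; ∈-concatMap⁺; ∈-concatMap⁻; ∈-upTo⁺; ∈-upTo⁻; ∈-allFin;
         ∈-cartesianProductWith⁺; ∈-cartesianProductWith⁻; deduplicate-∈⇔)
open import Data.List.Membership.Propositional.Properties.WithK using (unique∧set⇒bag)
open import Data.List.Relation.Binary.BagAndSetEquality using (∼bag⇒↭)
open import Data.List.Relation.Binary.Permutation.Propositional.Properties using (↭-length)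
open import Data.List.Relation.Unary.Unique.Propositional using (Unique)
open import Data.List.Relation.Unary.Unique.Propositional.Properties
  using (map⁺; upTo⁺; allFin⁺; cartesianProductWith⁺)
open import Data.List.Relation.Unary.Unique.DecPropositional.Properties _≟_ using (deduplicate-!)
open import Data.Product using (_×_; ∃; ∃₂; _,_)
open import Data.Sum using (inj₁; inj₂)
open import Function.Bundles using (mk⇔; Equivalence)
import Function.Properties.Equivalence as ⇔
open import Relation.Binary.PropositionalEquality
  using (_≡_; refl; sym; trans; cong; cong₂; subst; module ≡-Reasoning)

open ≡-Reasoning

≈ₛ-sym : ∀ {A B} → A ≈ₛ B → B ≈ₛ A
≈ₛ-sym A≈B x = ⇔.sym (A≈B x)

≈ₛ-trans : ∀ {A B C} → A ≈ₛ B → B ≈ₛ C → A ≈ₛ C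
≈ₛ-trans A≈B B≈C x = ⇔.trans (A≈B x) (B≈C x)

≈ₛ-deduplicate : ∀ A → A ≈ₛ deduplicate _≟_ A
≈ₛ-deduplicate A x = deduplicate-∈⇔ _≟_

length-unique-≈ₛ : ∀ {xs ys} → Unique xs → Unique ys → xs ≈ₛ ys → length xs ≡ length ys
length-unique-≈ₛ xs! ys! xs≈ys = ↭-length (∼bag⇒↭ (unique∧set⇒bag xs! ys! (λ {x} → xs≈ys x)))

card-cong : ∀ {A B} → A ≈ₛ B → card A ≡ card B
card-cong {A} {B} A≈B = length-unique-≈ₛ (deduplicate-! A) (deduplicate-! B)
  (≈ₛ-trans (≈ₛ-sym (≈ₛ-deduplicate A)) (≈ₛ-trans A≈B (≈ₛ-deduplicate B)))

card-unique : ∀ {A} → Unique A → card A ≡ length A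
card-unique {A} A! = length-unique-≈ₛ (deduplicate-! A) A! (≈ₛ-sym (≈ₛ-deduplicate A))

∈-⊕⁺ : ∀ {A B a b} → a ∈ A → b ∈ B → a + b ∈ A ⊕ B
∈-⊕⁺ {a = a} a∈A b∈B = ∈-concatMap⁺ _ (lose a∈A (∈-map⁺ (a +_) b∈B))

∈-⊕⁻ : ∀ A B {x} → x ∈ A ⊕ B → ∃₂ λ a b → a ∈ A × b ∈ B × x ≡ a + b
∈-⊕⁻ A B x∈A⊕B with a , a∈A , x∈a+B ← find (∈-concatMap⁻ _ {xs = A} x∈A⊕B)
                with b , b∈B , refl ← ∈-map⁻ _ x∈a+B = a , b , a∈A , b∈B , refl

⊕-comm : ∀ A B → (A ⊕ B) ≈ₛ (B ⊕ A)
⊕-comm A B x = mk⇔ (swap {A} {B}) (swap {B} {A})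
  where
  swap : ∀ {A B} → x ∈ A ⊕ B → x ∈ B ⊕ A
  swap {A} {B} x∈ with a , b , a∈A , b∈B , refl ← ∈-⊕⁻ A B x∈ =
    subst (_∈ B ⊕ A) (+-comm b a) (∈-⊕⁺ b∈B a∈A)

⊕-cong : ∀ {A A′ B B′} → A ≈ₛ A′ → B ≈ₛ B′ → (A ⊕ B) ≈ₛ (A′ ⊕ B′)
⊕-cong A≈A′ B≈B′ x = mk⇔ (transport A≈A′ B≈B′) (transport (≈ₛ-sym A≈A′) (≈ₛ-sym B≈B′))
  where
  transport : ∀ {A A′ B B′} → A ≈ₛ A′ → B ≈ₛ B′ → x ∈ A ⊕ B → x ∈ A′ ⊕ B′
  transport {A} {A′} {B} {B′} A≈A′ B≈B′ x∈ with a , b , a∈A , b∈B , refl ← ∈-⊕⁻ A B x∈ =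
    ∈-⊕⁺ (Equivalence.to (A≈A′ a) a∈A) (Equivalence.to (B≈B′ b) b∈B)

length-cartesianProductWith : ∀ {A B C : Set} (f : A → B → C) xs ys →
  length (cartesianProductWith f xs ys) ≡ length xs * length ys
length-cartesianProductWith f []       ys = refl
length-cartesianProductWith f (x ∷ xs) ys = begin
  length (map (f x) ys ++ cartesianProductWith f xs ys)
    ≡⟨ length-++ (map (f x) ys) ⟩
  length (map (f x) ys) + length (cartesianProductWith f xs ys)
    ≡⟨ cong₂ _+_ (length-map (f x) ys) (length-cartesianProductWith f xs ys) ⟩
  length ys + length xs * length ys ∎

length-allFin : ∀ k → length (allFin k) ≡ k
length-allFin k = length-tabulate (λ i → i)

digits-injective : ∀ {K i i′ j j′} → i < K → i′ < K →
  i + j * K ≡ i′ + j′ * K → i ≡ i′ × j ≡ j′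
digits-injective {K@(suc _)} {i} {i′} {j} {j′} i<K i′<K eq = i≡i′ , j≡j′
  where
  i≡i′ : i ≡ i′
  i≡i′ = begin
    i                ≡⟨ m<n⇒m%n≡m i<K ⟨
    i % K            ≡⟨ [m+kn]%n≡m%n i j K ⟨
    (i + j * K) % K  ≡⟨ cong (_% K) eq ⟩
    (i′ + j′ * K) % K ≡⟨ [m+kn]%n≡m%n i′ j′ K ⟩
    i′ % K           ≡⟨ m<n⇒m%n≡m i′<K ⟩
    i′               ∎
  j≡j′ : j ≡ j′
  j≡j′ = *-cancelʳ-≡ j j′ K (+-cancelˡ-≡ i′ _ _ (subst (λ l → l + j * K ≡ i′ + j′ * K) i≡i′ eq))

ap : ℕ → ℕ → ℕ → FinSet
ap a d k = map (λ i → a + i * d) (upTo k)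

∈-ap⁺ : ∀ {a d k i} → i < k → a + i * d ∈ ap a d k
∈-ap⁺ {a} {d} i<k = ∈-map⁺ (λ i → a + i * d) (∈-upTo⁺ i<k)

∈-ap⁻ : ∀ {a d k x} → x ∈ ap a d k → ∃ λ i → i < k × x ≡ a + i * d
∈-ap⁻ x∈ with i , i∈ , refl ← ∈-map⁻ _ x∈ = i , ∈-upTo⁻ i∈ , refl

card-ap : ∀ a d k .{{_ : NonZero d}} → card (ap a d k) ≡ k
card-ap a d k = begin
  card (ap a d k)    ≡⟨ card-unique (map⁺ step-injective (upTo⁺ k)) ⟩
  length (ap a d k)  ≡⟨ length-map _ (upTo k) ⟩
  length (upTo k)    ≡⟨ length-upTo k ⟩
  k                  ∎
  where
  step-injective : ∀ {i j} → a + i * d ≡ a + j * d → i ≡ j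
  step-injective {i} {j} eq = *-cancelʳ-≡ i j d (+-cancelˡ-≡ a _ _ eq)

card-ap-⊕-ap : ∀ a b d K k m .{{_ : NonZero d}} → k ≤ K →
  card (ap a d k ⊕ ap b (K * d) m) ≡ k * m
card-ap-⊕-ap a b d K k m k≤K = begin
  card (ap a d k ⊕ ap b (K * d) m)
    ≡⟨ card-cong sum≈grid ⟩
  card grid
    ≡⟨ card-unique (cartesianProductWith⁺ g g-injective (allFin⁺ k) (allFin⁺ m)) ⟩
  length grid
    ≡⟨ length-cartesianProductWith g (allFin k) (allFin m) ⟩
  length (allFin k) * length (allFin m)
    ≡⟨ cong₂ _*_ (length-allFin k) (length-allFin m) ⟩
  k * m ∎
  where
  open +-*-Solver

  -- Indexed by Fin rather than ℕ because g is injective only on digits i < k ≤ K.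
  g : Fin k → Fin m → ℕ
  g i j = a + b + (toℕ i + toℕ j * K) * d

  grid : List ℕ
  grid = cartesianProductWith g (allFin k) (allFin m)

  sum≡g : ∀ i j → (a + i * d) + (b + j * (K * d)) ≡ a + b + (i + j * K) * d
  sum≡g i j = solve 6 (λ a b d K i j → (a :+ i :* d) :+ (b :+ j :* (K :* d))
                                    := a :+ b :+ (i :+ j :* K) :* d) refl a b d K i j

  g-injective : ∀ {i i′ j j′} → g i j ≡ g i′ j′ → i ≡ i′ × j ≡ j′
  g-injective {i} {i′} eq
    with i≡i′ , j≡j′ ← digits-injective (<-≤-trans (toℕ<n i) k≤K) (<-≤-trans (toℕ<n i′) k≤K)
                         (*-cancelʳ-≡ _ _ d (+-cancelˡ-≡ (a + b) _ _ eq))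
    = toℕ-injective i≡i′ , toℕ-injective j≡j′

  sum⊆grid : ∀ {x} → x ∈ ap a d k ⊕ ap b (K * d) m → x ∈ grid
  sum⊆grid x∈ with _ , _ , x₁∈ , x₂∈ , refl ← ∈-⊕⁻ (ap a d k) (ap b (K * d) m) x∈
              with i , i<k , refl ← ∈-ap⁻ {a} {d} x₁∈ | j , j<m , refl ← ∈-ap⁻ {b} {K * d} x₂∈ =
    subst (_∈ grid) (sym sum≡gij) (∈-cartesianProductWith⁺ g (∈-allFin (fromℕ< i<k)) (∈-allFin (fromℕ< j<m)))
    where
    sum≡gij : (a + i * d) + (b + j * (K * d)) ≡ g (fromℕ< i<k) (fromℕ< j<m)
    sum≡gij = trans (sum≡g i j)
      (cong₂ (λ i′ j′ → a + b + (i′ + j′ * K) * d) (sym (toℕ-fromℕ< i<k)) (sym (toℕ-fromℕ< j<m)))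

  grid⊆sum : ∀ {x} → x ∈ grid → x ∈ ap a d k ⊕ ap b (K * d) m
  grid⊆sum x∈ with i , j , _ , _ , refl ← ∈-cartesianProductWith⁻ g (allFin k) (allFin m) x∈ =
    subst (_∈ ap a d k ⊕ ap b (K * d) m) (sum≡g (toℕ i) (toℕ j)) (∈-⊕⁺ (∈-ap⁺ (toℕ<n i)) (∈-ap⁺ (toℕ<n j)))

  sum≈grid : (ap a d k ⊕ ap b (K * d) m) ≈ₛ grid
  sum≈grid x = mk⇔ sum⊆grid grid⊆sum

MultipleCond⇒card-⊕≡* : ∀ {A B dA dB} → IsAPWith A dA → IsAPWith B dB →
  MultipleCond A dA dB → card (A ⊕ B) ≡ card A * card B
MultipleCond⇒card-⊕≡* {A} {B} {dA}
  (a , k , _ , dA≥1 , A≈ap) (b , m , _ , dB≥1 , B≈ap) (K , |A|<K , refl) = begin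
    card (A ⊕ B)                     ≡⟨ card-cong (⊕-cong A≈ap B≈ap) ⟩
    card (ap a dA k ⊕ ap b (K * dA) m) ≡⟨ card-ap-⊕-ap a b dA K k m {{>-nonZero dA≥1}} k≤K ⟩
    k * m                            ≡⟨ cong₂ _*_ |A|≡k |B|≡m ⟨
    card A * card B                  ∎
  where
  |A|≡k : card A ≡ k
  |A|≡k = trans (card-cong A≈ap) (card-ap a dA k {{>-nonZero dA≥1}})
  |B|≡m : card B ≡ m
  |B|≡m = trans (card-cong B≈ap) (card-ap b (K * dA) m {{>-nonZero dB≥1}})
  k≤K : k ≤ K
  k≤K = <⇒≤ (subst (_< K) |A|≡k |A|<K)

mainTheorem1 : ∀ (n : ℕ) (G : Graph n) (f : Fin n → FinSet) →
    IsSemiArith1 G f → IsStrong G f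
mainTheorem1 n G f ((iasi , vertex-ap) , multiple) = iasi , edge-strong
  where
  edge-strong : ∀ u v → Adj G u v → card (f u ⊕ f v) ≡ card (f u) * card (f v)
  edge-strong u v uv with du , u-ap ← vertex-ap u | dv , v-ap ← vertex-ap v
                     with multiple u v uv du dv u-ap v-ap
  ... | inj₁ u-divides = MultipleCond⇒card-⊕≡* u-ap v-ap u-divides
  ... | inj₂ v-divides = begin
    card (f u ⊕ f v)        ≡⟨ card-cong (⊕-comm (f u) (f v)) ⟩
    card (f v ⊕ f u)        ≡⟨ MultipleCond⇒card-⊕≡* v-ap u-ap v-divides ⟩
    card (f v) * card (f u) ≡⟨ *-comm (card (f v)) (card (f u)) ⟩
    card (f u) * card (f v) ∎
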